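{- Let $D$ be a Bernstein oriented graph with vertex set $[n]$ in which every arc between $i$ and $j$ with $i<j$ is directed from $i$ to $j$. Let $F$ be the undirected graph with vertex set $\{a_1^+,a_n^-\}\cup\bigcup_{i=2}^{n-1}\{a_i^+,a_i^-\}$ and edge set $\{\{a_i^+,a_j^-\}:(i,j)\text{ is an arc of }D\}$. Then $F$ is a forest.
   Context: An alternating closed trail in an oriented graph is a cyclic sequence of distinct arcs $e_0,\dots,e_{2m}=e_0$ such that (indices mod $2m$) $e_i,e_{i+1}$ share a vertex $v_i$ and are both directed into or both out of $v_i$, and $v_i\ne v_{i+1}$ for each $i$ (non-consecutive $v_i,v_j$ may coincide). An oriented graph is Bernstein if it has no directed cycle and no alternating closed trail. The $a_i^{\pm}$ are formal distinct symbols. -}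

module Defs where

open import Data.Nat using (ℕ; zero; suc; _+_; _*_; _<_; _≤_)
open import Data.Nat.DivMod using (_%_; m%n<n)
open import Data.Fin using (Fin; toℕ; fromℕ<) renaming (_<_ to _<ᶠ_)
open import Data.Product using (Σ; _×_; _,_; proj₁; proj₂)
open import Data.Sum using (_⊎_)
open import Data.Empty using (⊥)
open import Relation.Nullary using (¬_)
open import Relation.Binary.PropositionalEquality using (_≡_; _≢_)
open import Function.Definitions using (Injective)

next : ∀ {k} → Fin (suc k) → Fin (suc k)
next {k} i = fromℕ< (m%n<n (suc (toℕ i)) (suc k))

record OrientedGraph (n : ℕ) : Set₁ where
  field
    Arc     : Fin n → Fin n → Set
    noLoop  : ∀ i → ¬ Arc i i
    noTwo   : ∀ i j → Arc i j → ¬ Arc j i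

open OrientedGraph public

ArcOf : ∀ {n} → OrientedGraph n → Set
ArcOf {n} D = Σ (Fin n × Fin n) λ p → Arc D (proj₁ p) (proj₂ p)

tail head : ∀ {n} {D : OrientedGraph n} → ArcOf D → Fin n
tail e = proj₁ (proj₁ e)
head e = proj₂ (proj₁ e)

DirectedCycle : ∀ {n} → OrientedGraph n → Set
DirectedCycle {n} D =
  Σ ℕ λ k → Σ (Fin (suc k) → Fin n) λ w →
    Injective _≡_ _≡_ w × (∀ i → Arc D (w i) (w (next i)))

-- An alternating closed trail: cyclic sequence of 2m (m ≥ 1) distinct arcs e_i,
-- with vertices v_i such that e_i and e_{i+1} both have v_i as tail or both
-- have v_i as head, and v_i ≠ v_{i+1} (indices mod 2m).
-- Here 2m = suc k with suc k = 2 * suc m'.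
AlternatingClosedTrail : ∀ {n} → OrientedGraph n → Set
AlternatingClosedTrail {n} D =
  Σ ℕ λ m' → Σ ℕ λ k → (suc k ≡ 2 * suc m') ×
    (Σ (Fin (suc k) → ArcOf D) λ e → Σ (Fin (suc k) → Fin n) λ v →
      (∀ i j → proj₁ (e i) ≡ proj₁ (e j) → i ≡ j) ×
      (∀ i → ((tail {D = D} (e i) ≡ v i) × (tail {D = D} (e (next i)) ≡ v i))
           ⊎ ((head {D = D} (e i) ≡ v i) × (head {D = D} (e (next i)) ≡ v i))) ×
      (∀ i → v i ≢ v (next i)))

Bernstein : ∀ {n} → OrientedGraph n → Set
Bernstein D = ¬ DirectedCycle D × ¬ AlternatingClosedTrail D

Increasing : ∀ {n} → OrientedGraph n → Set
Increasing {n} D = ∀ (i j : Fin n) → Arc D i j → i <ᶠ j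

-- Vertices of F (0-indexed: Fin n index i stands for i+1 ∈ [n]):
-- a_i^+ for i ∈ [n] with i ≠ n, and a_j^- for j ∈ [n] with j ≠ 1.
data FVertex (n : ℕ) : Set where
  plus  : (i : Fin n) → suc (toℕ i) < n → FVertex n
  minus : (j : Fin n) → 0 < toℕ j → FVertex n

FAdj : ∀ {n} → OrientedGraph n → FVertex n → FVertex n → Set
FAdj D (plus i _)  (minus j _) = Arc D i j
FAdj D (minus j _) (plus i _)  = Arc D i j
FAdj D (plus _ _)  (plus _ _)  = ⊥
FAdj D (minus _ _) (minus _ _) = ⊥

HasCycle : {V : Set} → (V → V → Set) → Set
HasCycle {V} Adj =
  Σ ℕ λ k → Σ (Fin (suc (suc (suc k))) → V) λ c →
    Injective _≡_ _≡_ c × (∀ i → Adj (c i) (c (next i)))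

IsForest : {V : Set} → (V → V → Set) → Set
IsForest Adj = ¬ HasCycle Adj

{-# OPTIONS --safe #-}

-- F is bipartite between the a⁺ and the a⁻, and an edge a_i⁺a_j⁻ is the arc
-- (i , j). Walking around a cycle of F, two consecutive edges share either
-- some a_i⁺, so both arcs leave i, or some a_j⁻, so both arcs enter j. The
-- cycle has even length by bipartiteness, its edges are distinct arcs because
-- a cycle of length at least 3 never backtracks, and consecutive shared
-- vertices differ because they are the two ends of an arc. Hence a cycle of F
-- is an alternating closed trail of D.

module Submission where

open import Data.Nat using (ℕ)
open import Defs

open import Data.Nat using (zero; suc; _+_; _*_; _∸_; _≤_; NonZero)
open import Data.Nat.Properties
  using (<-irrelevant; <⇒≤; 1+n≢0; +-comm; *-suc; m∸n+n≡m; m+[n∸m]≡n)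
open import Data.Nat.DivMod
  using (_%_; _mod_; m%n<n; %-distribˡ-+; m%n%n≡m%n; n%n≡0; [m+n]%n≡m%n; m<n⇒m%n≡m)
open import Data.Fin using (Fin; toℕ)
open import Data.Fin.Properties using (toℕ<n; toℕ-fromℕ<; fromℕ<-cong)
open import Data.Bool using (Bool; true; false; not)
open import Data.Bool.Properties using (not-involutive; not-¬)
open import Data.Product using (∃-syntax; _×_; _,_; proj₁)
open import Data.Sum using (_⊎_; inj₁; inj₂)
open import Data.Empty using (⊥-elim)
open import Function using (_∘_)
open import Relation.Binary.PropositionalEquality
open ≡-Reasoning

m%d≡n%d⇒[o+m]%d≡[o+n]%d : ∀ {m n} o d .{{_ : NonZero d}} →
  m % d ≡ n % d → (o + m) % d ≡ (o + n) % d
m%d≡n%d⇒[o+m]%d≡[o+n]%d {m} {n} o d m%d≡n%d = begin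
  (o + m) % d              ≡⟨ %-distribˡ-+ o m d ⟩
  (o % d + m % d) % d      ≡⟨ cong (λ r → (o % d + r) % d) m%d≡n%d ⟩
  (o % d + n % d) % d      ≡⟨ %-distribˡ-+ o n d ⟨
  (o + n) % d              ∎

[1+m%d]%d≡[1+m]%d : ∀ m d .{{_ : NonZero d}} → suc (m % d) % d ≡ suc m % d
[1+m%d]%d≡[1+m]%d m d = m%d≡n%d⇒[o+m]%d≡[o+n]%d 1 d (m%n%n≡m%n m d)

toℕ-next : ∀ {k} (i : Fin (suc k)) → toℕ (next i) ≡ suc (toℕ i) % suc k
toℕ-next i = toℕ-fromℕ< _

next-mod : ∀ {k} t → next (t mod suc k) ≡ suc t mod suc k
next-mod {k} t = fromℕ<-cong _ _ (begin
  suc (toℕ (t mod suc k)) % suc k  ≡⟨ cong (λ r → suc r % suc k) (toℕ-fromℕ< _) ⟩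
  suc (t % suc k) % suc k          ≡⟨ [1+m%d]%d≡[1+m]%d t (suc k) ⟩
  suc t % suc k                    ∎) _ _

-- A fixed point of next ∘ next would give 2 ≡ 0 modulo N ≥ 3.
next∘next≢id : ∀ {k} (i : Fin (suc (suc (suc k)))) → next (next i) ≢ i
next∘next≢id {k} i next²i≡i = 1+n≢0 (begin
  2                             ≡⟨ [m+n]%n≡m%n 2 N ⟨
  (2 + N) % N                   ≡⟨ cong (λ r → (2 + r) % N) (m+[n∸m]≡n x≤N) ⟨
  (2 + x + (N ∸ x)) % N         ≡⟨ cong (_% N) (+-comm (2 + x) (N ∸ x)) ⟩
  (N ∸ x + (2 + x)) % N         ≡⟨ m%d≡n%d⇒[o+m]%d≡[o+n]%d (N ∸ x) N [2+x]%N≡x%N ⟩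
  (N ∸ x + x) % N               ≡⟨ cong (_% N) (m∸n+n≡m x≤N) ⟩
  N % N                         ≡⟨ n%n≡0 N ⟩
  0                             ∎)
  where
  N : ℕ
  N = suc (suc (suc k))
  x : ℕ
  x = toℕ i
  x≤N : x ≤ N
  x≤N = <⇒≤ (toℕ<n i)
  [2+x]%N≡x%N : (2 + x) % N ≡ x % N
  [2+x]%N≡x%N = begin
    (2 + x) % N                 ≡⟨ [1+m%d]%d≡[1+m]%d (suc x) N ⟨
    suc (suc x % N) % N         ≡⟨ cong (λ r → suc r % N) (toℕ-next i) ⟨
    suc (toℕ (next i)) % N      ≡⟨ toℕ-next (next i) ⟨
    toℕ (next (next i))         ≡⟨ cong toℕ next²i≡i ⟩
    x                           ≡⟨ m<n⇒m%n≡m (toℕ<n i) ⟨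
    x % N                       ∎

alternating-return⇒even : (b : ℕ → Bool) → (∀ t → b (suc t) ≡ not (b t)) →
  ∀ t → b t ≡ b 0 → ∃[ h ] t ≡ 2 * h
alternating-return⇒even b alt zero _ = 0 , refl
alternating-return⇒even b alt (suc zero) b₁≡b₀ =
  ⊥-elim (not-¬ refl (sym (trans (sym (alt 0)) b₁≡b₀)))
alternating-return⇒even b alt (suc (suc t)) b₂₊ₜ≡b₀ =
  let h , t≡2h = alternating-return⇒even b alt t (trans (sym b₂₊ₜ≡bₜ) b₂₊ₜ≡b₀)
  in  suc h , trans (cong (2 +_) t≡2h) (sym (*-suc 2 h))
  where
  b₂₊ₜ≡bₜ : b (suc (suc t)) ≡ b t
  b₂₊ₜ≡bₜ = trans (alt (suc t)) (trans (cong not (alt t)) (not-involutive (b t)))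

alternating-cycle-even : ∀ {k} (b : Fin (suc k) → Bool) →
  (∀ i → b (next i) ≡ not (b i)) → ∃[ m ] suc k ≡ 2 * suc m
alternating-cycle-even {k} b alt =
  positive (alternating-return⇒even (b ∘ (_mod suc k)) alt′ (suc k) returns)
  where
  alt′ : ∀ t → b (suc t mod suc k) ≡ not (b (t mod suc k))
  alt′ t = trans (cong b (sym (next-mod t))) (alt (t mod suc k))
  returns : b (suc k mod suc k) ≡ b (0 mod suc k)
  returns = cong b (fromℕ<-cong _ 0 (n%n≡0 (suc k)) _ (m%n<n 0 (suc k)))
  positive : ∃[ h ] suc k ≡ 2 * h → ∃[ m ] suc k ≡ 2 * suc m
  positive (suc m , length≡2m) = m , length≡2m

module _ {n : ℕ} (D : OrientedGraph n) where

  vertex : FVertex n → Fin n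
  vertex (plus i _)  = i
  vertex (minus j _) = j

  isPlus : FVertex n → Bool
  isPlus (plus _ _)  = true
  isPlus (minus _ _) = false

  arcOf : ∀ x y → FAdj D x y → ArcOf D
  arcOf (plus i _)  (minus j _) a = (i , j) , a
  arcOf (minus j _) (plus i _)  a = (i , j) , a

  BothOutOrBothIn : ArcOf D → ArcOf D → Fin n → Set
  BothOutOrBothIn e f v = (tail {D = D} e ≡ v × tail {D = D} f ≡ v)
                        ⊎ (head {D = D} e ≡ v × head {D = D} f ≡ v)

  FAdj⇒isPlus-flips : ∀ x y → FAdj D x y → isPlus y ≡ not (isPlus x)
  FAdj⇒isPlus-flips (plus _ _)  (minus _ _) _ = refl
  FAdj⇒isPlus-flips (minus _ _) (plus _ _)  _ = refl

  FAdj⇒vertex≢ : ∀ x y → FAdj D x y → vertex x ≢ vertex y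
  FAdj⇒vertex≢ (plus i _)  (minus .i _) a refl = noLoop D i a
  FAdj⇒vertex≢ (minus j _) (plus .j _)  a refl = noLoop D j a

  consecutive-arcs-meet : ∀ x y z (a : FAdj D x y) (b : FAdj D y z) →
    BothOutOrBothIn (arcOf x y a) (arcOf y z b) (vertex y)
  consecutive-arcs-meet (minus _ _) (plus _ _)  (minus _ _) _ _ = inj₁ (refl , refl)
  consecutive-arcs-meet (plus _ _)  (minus _ _) (plus _ _)  _ _ = inj₂ (refl , refl)

  arcOf-injective : ∀ x y x′ y′ (a : FAdj D x y) (a′ : FAdj D x′ y′) →
    proj₁ (arcOf x y a) ≡ proj₁ (arcOf x′ y′ a′) →
    (x ≡ x′ × y ≡ y′) ⊎ (x ≡ y′ × y ≡ x′)
  arcOf-injective (plus i p) (minus j q) (plus .i p′) (minus .j q′) _ _ refl =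
    inj₁ (cong (plus i) (<-irrelevant p p′) , cong (minus j) (<-irrelevant q q′))
  arcOf-injective (plus i p) (minus j q) (minus .j q′) (plus .i p′) _ _ refl =
    inj₂ (cong (plus i) (<-irrelevant p p′) , cong (minus j) (<-irrelevant q q′))
  arcOf-injective (minus j q) (plus i p) (plus .i p′) (minus .j q′) _ _ refl =
    inj₂ (cong (minus j) (<-irrelevant q q′) , cong (plus i) (<-irrelevant p p′))
  arcOf-injective (minus j q) (plus i p) (minus .j q′) (plus .i p′) _ _ refl =
    inj₁ (cong (minus j) (<-irrelevant q q′) , cong (plus i) (<-irrelevant p p′))

  cycle⇒alternatingClosedTrail : HasCycle (FAdj D) → AlternatingClosedTrail D
  cycle⇒alternatingClosedTrail (k , c , c-injective , adj) =
    let m , length≡2m = alternating-cycle-even (isPlus ∘ c) isPlus-alternates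
    in  m , suc (suc k) , length≡2m , e , v , e-injective , e-meet , v-distinct
    where
    isPlus-alternates : ∀ i → isPlus (c (next i)) ≡ not (isPlus (c i))
    isPlus-alternates i = FAdj⇒isPlus-flips (c i) (c (next i)) (adj i)

    e : Fin (suc (suc (suc k))) → ArcOf D
    e i = arcOf (c i) (c (next i)) (adj i)

    v : Fin (suc (suc (suc k))) → Fin n
    v i = vertex (c (next i))

    e-meet : ∀ i → BothOutOrBothIn (e i) (e (next i)) (v i)
    e-meet i = consecutive-arcs-meet (c i) (c (next i)) (c (next (next i))) (adj i) (adj (next i))

    v-distinct : ∀ i → v i ≢ v (next i)
    v-distinct i = FAdj⇒vertex≢ (c (next i)) (c (next (next i))) (adj (next i))

    e-injective : ∀ i j → proj₁ (e i) ≡ proj₁ (e j) → i ≡ j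
    e-injective i j eᵢ≡eⱼ
      with arcOf-injective (c i) (c (next i)) (c j) (c (next j)) (adj i) (adj j) eᵢ≡eⱼ
    ... | inj₁ (cᵢ≡cⱼ , _) = c-injective cᵢ≡cⱼ
    ... | inj₂ (cᵢ≡cⱼ₊₁ , cᵢ₊₁≡cⱼ) = ⊥-elim (next∘next≢id i
          (trans (cong next (c-injective cᵢ₊₁≡cⱼ)) (sym (c-injective cᵢ≡cⱼ₊₁))))

lemma2p7 : (n : ℕ) (D : OrientedGraph n) → Increasing D → Bernstein D →
    IsForest (FAdj D)
lemma2p7 n D _ (_ , noAlternatingClosedTrail) =
  noAlternatingClosedTrail ∘ cycle⇒alternatingClosedTrail D
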